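{- Any randomized one-pass streaming algorithm that maintains (outputs) the cost of an optimal correlation clustering solution with probability greater than $\frac{2}{3}$ requires $\Omega(n^2)$ bits of memory, where $n$ is the number of vertices.
   Context: Correlation clustering: the input is a complete graph on $n$ vertices in which every edge is labeled $+$ or $-$; the labeled edges arrive one by one in a stream in arbitrary order. The cost of a partition of the vertices into clusters is the number of $+$ edges between different clusters plus the number of $-$ edges inside clusters; an optimal solution is a partition of minimum cost. -}

module Defs where

open import Data.Nat using (ℕ; zero; suc; _+_; _*_; _^_; _≤_; _<_; _<ᵇ_)
open import Data.Fin using (Fin; toℕ; _≟_)
open import Data.Fin.Subset using (Subset; _∈_; ∣_∣)
open import Data.Bool using (Bool; true; false; if_then_else_)
open import Data.List using (List; []; _∷_; [_]; map; concatMap; foldl; allFin)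
open import Data.Nat.ListAction using (sum)
open import Relation.Binary.PropositionalEquality using (_≡_)
open import Data.Product using (Σ)
open import Data.List.Relation.Binary.Permutation.Propositional using (_↭_)
open import Data.Product using (_×_; _,_; ∃; ∃-syntax)
open import Relation.Nullary.Decidable using (⌊_⌋)

-- A labeling assigns to each pair (i , j) a sign: true = '+', false = '-'.
-- Only pairs with i < j (the edges of K_n) are ever consulted.
Labeling : ℕ → Set
Labeling n = Fin n → Fin n → Bool

Edge : ℕ → Set
Edge n = Fin n × Fin n

allEdges : (n : ℕ) → List (Edge n)
allEdges n =
  concatMap (λ i → concatMap (λ j → if toℕ i <ᵇ toℕ j then [ (i , j) ] else [])
                             (allFin n))
            (allFin n)

-- A clustering (partition of the vertices): every partition of n vertices
-- into clusters can be described by assigning each vertex a cluster label in Fin n.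
Clustering : ℕ → Set
Clustering n = Fin n → Fin n

edgeCost : ∀ {n} → Labeling n → Clustering n → Edge n → ℕ
edgeCost σ c (i , j) with σ i j | ⌊ c i ≟ c j ⌋
... | true  | true  = 0
... | true  | false = 1
... | false | true  = 1
... | false | false = 0

cost : ∀ {n} → Labeling n → Clustering n → ℕ
cost {n} σ c = sum (map (edgeCost σ c) (allEdges n))

IsOptCost : ∀ {n} → Labeling n → ℕ → Set
IsOptCost {n} σ v = (∃[ c ] cost σ c ≡ v) × (∀ c → v ≤ cost σ c)

StreamItem : ℕ → Set
StreamItem n = Fin n × Fin n × Bool

streamOf : ∀ {n} → Labeling n → List (Edge n) → List (StreamItem n)
streamOf σ = map (λ { (i , j) → (i , j , σ i j) })

ValidOrder : (n : ℕ) → List (Edge n) → Set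
ValidOrder n es = es ↭ allEdges n

-- A randomized one-pass streaming algorithm on n-vertex inputs using b bits of
-- memory and a uniformly random seed from Fin R (public randomness; the seed
-- need not be stored).
record StreamAlg (n b R : ℕ) : Set where
  field
    init   : Fin R → Fin (2 ^ b)
    step   : Fin R → Fin (2 ^ b) → StreamItem n → Fin (2 ^ b)
    output : Fin R → Fin (2 ^ b) → ℕ

open StreamAlg public

run : ∀ {n b R} → StreamAlg n b R → Fin R → List (StreamItem n) → ℕ
run A r xs = output A r (foldl (step A r) (init A r) xs)

-- A outputs the optimal cost with probability > 2/3 on every input stream:
-- for every labeling and every edge order there is a set S of seeds with
-- |S| / R > 2/3 such that on every seed in S the output is the optimal cost.
Correct : ∀ {n b R} → StreamAlg n b R → Set
Correct {n} {b} {R} A =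
  ∀ (σ : Labeling n) (es : List (Edge n)) → ValidOrder n es →
  Σ (Subset R) λ S → (2 * R < 3 * ∣ S ∣) ×
    (∀ (r : Fin R) → r ∈ S → IsOptCost σ (run A r (streamOf σ es)))

-- Reduction from the one-way Index problem.  Alice's string x of length m = 70v² becomes the signs of the
-- edges between a row block A and a column block B, and Bob's index (a₀, p₀) fixes all other signs.  If
-- x (a₀, p₀) = 1 a canonical clustering costs less than |A|·v, while if x (a₀, p₀) = 0 edge-disjoint bad
-- triangles (two + edges, one − edge) force every clustering to cost at least |A|·v.  Streaming Alice's
-- edges first turns a b-bit streaming algorithm into a public-coin one-way protocol for Index with b-bit
-- messages, and ∑ₓ 2 ^ (agreement of x with its decoding) ≤ 2 ^ b · 3 ^ m shows that such a protocol
-- cannot be correct with probability above 2/3 unless b ≥ v² - 3, i.e. b = Ω(n²).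
module Submission where

open import Defs
open import Data.Nat using (ℕ; _*_; _≤_; _<_)
open import Data.Product using (Σ; ∃-syntax; _×_)

open import Data.Bool using (Bool; true; false; not; if_then_else_; _∧_)
open import Data.Empty using (⊥; ⊥-elim)
open import Data.Fin as Fin using (Fin; toℕ; fromℕ<; combine; remQuot)
open import Data.Fin.Properties using (toℕ-injective; toℕ<n; fromℕ<-toℕ; toℕ-fromℕ<; combine-remQuot)
open import Data.Fin.Subset using (Subset; _∈_; ∣_∣)
open import Data.List using (List; []; _∷_; [_]; map; concatMap; _++_; tabulate; allFin; foldl; filterᵇ)
open import Data.List.Properties using (map-++; map-tabulate; foldl-++)
open import Data.List.Relation.Binary.Permutation.Propositional as ↭ using (_↭_; prep)
open import Data.List.Relation.Binary.Permutation.Propositional.Properties using (shift)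
open import Data.Nat
open import Data.Nat.DivMod using (_/_; _%_; m≡m%n+[m/n]*n; m%n<n; m/n*n≤m; /-monoˡ-≤)
open import Data.Nat.ListAction as ListAction using ()
open import Data.Nat.ListAction.Properties using (sum-++)
open import Data.Nat.Properties
open import Data.Nat.Tactic.RingSolver using (solve-∀)
open import Algebra.Properties.CommutativeSemigroup +-commutativeSemigroup using () renaming (interchange to +-interchange)
open import Algebra.Properties.CommutativeSemigroup *-commutativeSemigroup using () renaming (interchange to *-interchange)
open import Algebra.Properties.Semiring.Sum +-*-semiring using (sum-syntax; sum-cong-≗; ∑-comm; ∑-distrib-+; *-distribˡ-sum)
open import Data.Product using (_,_; proj₁; proj₂)
open import Data.Vec using ([]; _∷_; lookup)
open import Data.Vec.Functional as Vector using ()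
open import Data.Vec.Properties using (lookup⇒[]=)
open import Function using (_∘_; id)
open import Relation.Binary.PropositionalEquality hiding ([_])
open import Relation.Nullary using (yes; no)
open import Relation.Nullary.Decidable using (⌊_⌋)

-- The gadget addresses its vertices arithmetically (block offset + position), so its costs are sums over ℕ-ranges.
sum< : ℕ → (ℕ → ℕ) → ℕ
sum< zero    f = 0
sum< (suc n) f = f 0 + sum< n (f ∘ suc)

sum<-+ : ∀ p q f → sum< (p + q) f ≡ sum< p f + sum< q (λ k → f (p + k))
sum<-+ zero    q f = refl
sum<-+ (suc p) q f = trans (cong (f 0 +_) (sum<-+ p q (f ∘ suc))) (sym (+-assoc (f 0) _ _))

sum<-mono-≤ : ∀ n {f g} → (∀ k → k < n → f k ≤ g k) → sum< n f ≤ sum< n g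
sum<-mono-≤ zero    f≤g = z≤n
sum<-mono-≤ (suc n) f≤g = +-mono-≤ (f≤g 0 z<s) (sum<-mono-≤ n (λ k k<n → f≤g (suc k) (s<s k<n)))

sum<-cong : ∀ n {f g} → (∀ k → k < n → f k ≡ g k) → sum< n f ≡ sum< n g
sum<-cong zero    f≡g = refl
sum<-cong (suc n) f≡g = cong₂ _+_ (f≡g 0 z<s) (sum<-cong n (λ k k<n → f≡g (suc k) (s<s k<n)))

sum<-distrib-+ : ∀ n f g → sum< n (λ k → f k + g k) ≡ sum< n f + sum< n g
sum<-distrib-+ zero    f g = refl
sum<-distrib-+ (suc n) f g =
  trans (cong (f 0 + g 0 +_) (sum<-distrib-+ n (f ∘ suc) (g ∘ suc)))
        (+-interchange (f 0) (g 0) (sum< n (f ∘ suc)) (sum< n (g ∘ suc)))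

sum<-distrib-+₃ : ∀ n f g h → sum< n (λ k → f k + g k + h k) ≡ sum< n f + sum< n g + sum< n h
sum<-distrib-+₃ n f g h = trans (sum<-distrib-+ n (λ k → f k + g k) h) (cong (_+ sum< n h) (sum<-distrib-+ n f g))

sum<-const : ∀ n c → sum< n (λ _ → c) ≡ n * c
sum<-const zero    c = refl
sum<-const (suc n) c = cong (c +_) (sum<-const n c)

sum<-zero : ∀ n f → (∀ k → k < n → f k ≡ 0) → sum< n f ≡ 0
sum<-zero n f f≡0 = trans (sum<-cong n f≡0) (trans (sum<-const n 0) (*-zeroʳ n))

sum<-+-zeroʳ : ∀ p q f → (∀ k → k < q → f (p + k) ≡ 0) → sum< (p + q) f ≡ sum< p f
sum<-+-zeroʳ p q f tail≡0 =
  trans (sum<-+ p q f) (trans (cong (sum< p f +_) (sum<-zero q _ tail≡0)) (+-identityʳ _))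

sum<-comm : ∀ m n (f : ℕ → ℕ → ℕ) → sum< m (λ i → sum< n (f i)) ≡ sum< n (λ j → sum< m (λ i → f i j))
sum<-comm zero    n f = sym (sum<-zero n _ (λ _ _ → refl))
sum<-comm (suc m) n f = trans (cong (sum< n (f 0) +_) (sum<-comm m n (f ∘ suc)))
                              (sym (sum<-distrib-+ n (f 0) (λ j → sum< m (λ i → f (suc i) j))))

term≤sum< : ∀ n f k → k < n → f k ≤ sum< n f
term≤sum< (suc n) f zero    _         = m≤m+n (f 0) _
term≤sum< (suc n) f (suc k) (s<s k<n) = ≤-trans (term≤sum< n (f ∘ suc) k k<n) (m≤n+m _ (f 0))

window≤sum< : ∀ s l n f → s + l ≤ n → sum< l (λ k → f (s + k)) ≤ sum< n f
window≤sum< s l n f s+l≤n with m≤n⇒∃[o]m+o≡n s+l≤n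
... | r , refl = begin
  sum< l (λ k → f (s + k))                                      ≤⟨ m≤n+m _ (sum< s f) ⟩
  sum< s f + sum< l (λ k → f (s + k))                           ≡⟨ sym (sum<-+ s l f) ⟩
  sum< (s + l) f                                                ≤⟨ m≤m+n _ _ ⟩
  sum< (s + l) f + sum< r (λ k → f (s + l + k))                 ≡⟨ sym (sum<-+ (s + l) r f) ⟩
  sum< (s + l + r) f                                            ∎
  where open ≤-Reasoning

sum<≤n*c : ∀ n c f → (∀ k → k < n → f k ≤ c) → sum< n f ≤ n * c
sum<≤n*c n c f f≤c = ≤-trans (sum<-mono-≤ n f≤c) (≤-reflexive (sum<-const n c))

sum<<n*c : ∀ n c f k₀ → k₀ < n → (∀ k → k < n → f k ≤ c) → f k₀ < c → sum< n f < n * c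
sum<<n*c (suc n) c f zero     _           f≤c fk₀<c =
  +-mono-≤ fk₀<c (sum<≤n*c n c (f ∘ suc) (λ k k<n → f≤c (suc k) (s<s k<n)))
sum<<n*c (suc n) c f (suc k₀) (s<s k₀<n) f≤c fk₀<c =
  subst (_≤ c + n * c) (+-suc (f 0) _)
    (+-mono-≤ (f≤c 0 z<s) (sum<<n*c n c (f ∘ suc) k₀ k₀<n (λ k k<n → f≤c (suc k) (s<s k<n)) fk₀<c))

sum<-mono-≤-except : ∀ n f g e k₀ → k₀ < n → (∀ k → k < n → k ≢ k₀ → g k ≤ f k) → g k₀ ≤ f k₀ + e →
                     sum< n g ≤ sum< n f + e
sum<-mono-≤-except (suc n) f g e zero _ g≤f gk₀≤ = begin
  g 0 + sum< n (g ∘ suc)     ≤⟨ +-mono-≤ gk₀≤ (sum<-mono-≤ n (λ k k<n → g≤f (suc k) (s<s k<n) (λ ()))) ⟩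
  f 0 + e + sum< n (f ∘ suc) ≡⟨ +-assoc (f 0) e _ ⟩
  f 0 + (e + sum< n (f ∘ suc)) ≡⟨ cong (f 0 +_) (+-comm e _) ⟩
  f 0 + (sum< n (f ∘ suc) + e) ≡⟨ sym (+-assoc (f 0) _ e) ⟩
  f 0 + sum< n (f ∘ suc) + e ∎
  where open ≤-Reasoning
sum<-mono-≤-except (suc n) f g e (suc k₀) (s<s k₀<n) g≤f gk₀≤ =
  subst (g 0 + sum< n (g ∘ suc) ≤_) (sym (+-assoc (f 0) _ e))
    (+-mono-≤ (g≤f 0 z<s (λ ()))
              (sum<-mono-≤-except n (f ∘ suc) (g ∘ suc) e k₀ k₀<n
                 (λ k k<n k≢k₀ → g≤f (suc k) (s<s k<n) (k≢k₀ ∘ suc-injective)) gk₀≤))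

<⇒<ᵇ≡true : ∀ {m n} → m < n → (m <ᵇ n) ≡ true
<⇒<ᵇ≡true {zero}  {suc n} _         = refl
<⇒<ᵇ≡true {suc m} {suc n} (s<s m<n) = <⇒<ᵇ≡true m<n

≥⇒<ᵇ≡false : ∀ {m n} → n ≤ m → (m <ᵇ n) ≡ false
≥⇒<ᵇ≡false {m}     {zero}  _         = refl
≥⇒<ᵇ≡false {suc m} {suc n} (s≤s n≤m) = ≥⇒<ᵇ≡false n≤m

≡ᵇ-refl : ∀ m → (m ≡ᵇ m) ≡ true
≡ᵇ-refl zero    = refl
≡ᵇ-refl (suc m) = ≡ᵇ-refl m

≢⇒≡ᵇ≡false : ∀ {m n} → m ≢ n → (m ≡ᵇ n) ≡ false
≢⇒≡ᵇ≡false {zero}  {zero}  m≢n = ⊥-elim (m≢n refl)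
≢⇒≡ᵇ≡false {zero}  {suc n} _   = refl
≢⇒≡ᵇ≡false {suc m} {zero}  _   = refl
≢⇒≡ᵇ≡false {suc m} {suc n} m≢n = ≢⇒≡ᵇ≡false (m≢n ∘ cong suc)

mismatch : Bool → Bool → ℕ
mismatch true  true  = 0
mismatch true  false = 1
mismatch false true  = 1
mismatch false false = 0

onlyIf : Bool → ℕ → ℕ
onlyIf true  x = x
onlyIf false x = 0

onlyIf≤ : ∀ b x → onlyIf b x ≤ x
onlyIf≤ true  x = ≤-refl
onlyIf≤ false x = z≤n

pairCost : (ℕ → ℕ → Bool) → (ℕ → ℕ) → ℕ → ℕ → ℕ
pairCost s K i j = mismatch (s i j) (K i ≡ᵇ K j)

rowCost : ℕ → (ℕ → ℕ → ℕ) → ℕ → ℕ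
rowCost n g i = sum< n (λ j → onlyIf (i <ᵇ j) (g i j))

upperSum : ℕ → (ℕ → ℕ → ℕ) → ℕ
upperSum n g = sum< n (rowCost n g)

clusterIndex : ∀ {n} → Clustering n → ℕ → ℕ
clusterIndex {n} c k with k <? n
... | yes k<n = toℕ (c (fromℕ< k<n))
... | no  _   = 0

clusterIndex-toℕ : ∀ {n} (c : Clustering n) i → clusterIndex c (toℕ i) ≡ toℕ (c i)
clusterIndex-toℕ {n} c i with toℕ i <? n
... | yes i<n = cong (toℕ ∘ c) (fromℕ<-toℕ i i<n)
... | no  i≮n = ⊥-elim (i≮n (toℕ<n i))

edgeCost≡mismatch : ∀ {n} (σ : Labeling n) c i j → edgeCost σ c (i , j) ≡ mismatch (σ i j) ⌊ c i Fin.≟ c j ⌋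
edgeCost≡mismatch σ c i j with σ i j | ⌊ c i Fin.≟ c j ⌋
... | true  | true  = refl
... | true  | false = refl
... | false | true  = refl
... | false | false = refl

⌊≟⌋≡≡ᵇ : ∀ {n} (a b : Fin n) → ⌊ a Fin.≟ b ⌋ ≡ (toℕ a ≡ᵇ toℕ b)
⌊≟⌋≡≡ᵇ a b with a Fin.≟ b
... | yes refl = sym (≡ᵇ-refl (toℕ a))
... | no  a≢b  = sym (≢⇒≡ᵇ≡false (a≢b ∘ toℕ-injective))

sum-concatMap : ∀ {A B : Set} (f : B → ℕ) (g : A → List B) xs →
                ListAction.sum (map f (concatMap g xs)) ≡ ListAction.sum (map (ListAction.sum ∘ map f ∘ g) xs)
sum-concatMap f g []       = refl
sum-concatMap f g (x ∷ xs) = begin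
  ListAction.sum (map f (g x ++ concatMap g xs))
    ≡⟨ cong ListAction.sum (map-++ f (g x) (concatMap g xs)) ⟩
  ListAction.sum (map f (g x) ++ map f (concatMap g xs))
    ≡⟨ sum-++ (map f (g x)) (map f (concatMap g xs)) ⟩
  ListAction.sum (map f (g x)) + ListAction.sum (map f (concatMap g xs))
    ≡⟨ cong (ListAction.sum (map f (g x)) +_) (sum-concatMap f g xs) ⟩
  ListAction.sum (map f (g x)) + ListAction.sum (map (ListAction.sum ∘ map f ∘ g) xs) ∎
  where open ≡-Reasoning

sum-tabulate : ∀ {n} (f : Fin n → ℕ) h → (∀ i → f i ≡ h (toℕ i)) → ListAction.sum (tabulate f) ≡ sum< n h
sum-tabulate {zero}  f h f≡h = refl
sum-tabulate {suc n} f h f≡h = cong₂ _+_ (f≡h Fin.zero) (sum-tabulate (f ∘ Fin.suc) (h ∘ suc) (f≡h ∘ Fin.suc))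

sum-allFin : ∀ {n} (f : Fin n → ℕ) h → (∀ i → f i ≡ h (toℕ i)) → ListAction.sum (map f (allFin n)) ≡ sum< n h
sum-allFin f h f≡h = trans (cong ListAction.sum (map-tabulate id f)) (sum-tabulate f h f≡h)

cost≡upperSum : ∀ n (s : ℕ → ℕ → Bool) (c : Clustering n) →
                cost (λ i j → s (toℕ i) (toℕ j)) c ≡ upperSum n (pairCost s (clusterIndex c))
cost≡upperSum n s c =
  trans (sum-concatMap (edgeCost σ c) edgesFrom (allFin n)) (sum-allFin _ _ λ i →
  trans (sum-concatMap (edgeCost σ c) (edgeIf i) (allFin n)) (sum-allFin _ _ λ j →
  termCost i j (toℕ i <ᵇ toℕ j)))
  where
  σ : Labeling n
  σ i j = s (toℕ i) (toℕ j)
  edgeIf : Fin n → Fin n → List (Edge n)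
  edgeIf i j = if toℕ i <ᵇ toℕ j then [ (i , j) ] else []
  edgesFrom : Fin n → List (Edge n)
  edgesFrom i = concatMap (edgeIf i) (allFin n)
  termCost : ∀ i j b → ListAction.sum (map (edgeCost σ c) (if b then [ (i , j) ] else []))
                       ≡ onlyIf b (pairCost s (clusterIndex c) (toℕ i) (toℕ j))
  termCost i j false = refl
  termCost i j true  = begin
    edgeCost σ c (i , j) + 0                  ≡⟨ +-identityʳ _ ⟩
    edgeCost σ c (i , j)                      ≡⟨ edgeCost≡mismatch σ c i j ⟩
    mismatch (σ i j) ⌊ c i Fin.≟ c j ⌋        ≡⟨ cong (mismatch (σ i j)) (⌊≟⌋≡≡ᵇ (c i) (c j)) ⟩
    mismatch (σ i j) (toℕ (c i) ≡ᵇ toℕ (c j)) ≡⟨ sym (cong₂ (λ p q → mismatch (σ i j) (p ≡ᵇ q))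
                                                     (clusterIndex-toℕ c i) (clusterIndex-toℕ c j)) ⟩
    pairCost s (clusterIndex c) (toℕ i) (toℕ j) ∎
    where open ≡-Reasoning

indicator : Bool → ℕ
indicator true  = 1
indicator false = 0

indicator≤ : ∀ b {x} → (b ≡ true → 1 ≤ x) → indicator b ≤ x
indicator≤ false _   = z≤n
indicator≤ true  1≤x = 1≤x refl

onlyIf-true : ∀ {b} x → b ≡ true → onlyIf b x ≡ x
onlyIf-true x refl = refl

badTriangle : ∀ p q r → 1 ≤ mismatch true (p ≡ᵇ q) + mismatch true (p ≡ᵇ r) + mismatch false (q ≡ᵇ r)
badTriangle p q r with p ≟ q
... | no p≢q rewrite ≢⇒≡ᵇ≡false p≢q = s≤s z≤n
... | yes refl with p ≟ r
...   | no p≢r rewrite ≢⇒≡ᵇ≡false p≢r | ≡ᵇ-refl p = s≤s z≤n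
...   | yes refl rewrite ≡ᵇ-refl p = s≤s z≤n

badTriangle′ : ∀ p q r → 1 ≤ mismatch true (p ≡ᵇ q) + mismatch false (p ≡ᵇ r) + mismatch true (q ≡ᵇ r)
badTriangle′ p q r with p ≟ q
... | no p≢q rewrite ≢⇒≡ᵇ≡false p≢q = s≤s z≤n
... | yes refl with p ≟ r
...   | no p≢r rewrite ≢⇒≡ᵇ≡false p≢r | ≡ᵇ-refl p = s≤s z≤n
...   | yes refl rewrite ≡ᵇ-refl p = s≤s z≤n

-- The vertices 0, 1, … form consecutive blocks: A = [0, LA) holds the rows a; B = [LA, OA) holds a column
-- LA + p and its complement LA + (v + p) for every p < v; W = [OA, OB) and W′ = [OB, TOT) are auxiliary;
-- all further vertices are isolated.  Alice's edges A × B carry the bits X a p; every other edge is +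
-- exactly when both ends have the same canonical cluster, the clusters being {a₀, LA + p₀}, (A ∖ a₀) ∪ W
-- and (B ∖ (LA + p₀)) ∪ W′.
module Gadget (v LA : ℕ) where

  LB LW OA OB TOT : ℕ
  LB  = v + v
  LW  = LA + LB
  OA  = LA + LB
  OB  = OA + LW
  TOT = OB + LB

  aliceEdge : ℕ → ℕ → Bool
  aliceEdge i j = (i <ᵇ LA) ∧ (not (j <ᵇ LA) ∧ (j <ᵇ OA))

  aliceLabel : (ℕ → ℕ → Bool) → ℕ → ℕ → Bool
  aliceLabel X a j = if (j ∸ LA) <ᵇ v then X a (j ∸ LA) else not (X a ((j ∸ LA) ∸ v))

  canonical : ℕ → ℕ → ℕ → ℕ
  canonical a₀ p₀ k =
    if      k <ᵇ LA  then (if k ≡ᵇ a₀ then 0 else 1)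
    else if k <ᵇ OA  then (if (k ∸ LA) ≡ᵇ p₀ then 0 else 2)
    else if k <ᵇ OB  then 1
    else if k <ᵇ TOT then 2
    else k

  label : (ℕ → ℕ → Bool) → ℕ → ℕ → ℕ → ℕ → Bool
  label X a₀ p₀ i j = if aliceEdge i j then aliceLabel X i j else (canonical a₀ p₀ i ≡ᵇ canonical a₀ p₀ j)

  OA≤OB+ : ∀ β → OA ≤ OB + β
  OA≤OB+ β = ≤-trans (m≤m+n OA LW) (m≤m+n OB β)

  OA≤TOT : OA ≤ TOT
  OA≤TOT = ≤-trans (m≤m+n OA LW) (m≤m+n OB LB)

  LA≤OA+ : ∀ q → LA ≤ OA + q
  LA≤OA+ q = ≤-trans (m≤m+n LA LB) (m≤m+n OA q)

  canonical-A : ∀ {a₀ p₀ k} → k < LA → canonical a₀ p₀ k ≡ (if k ≡ᵇ a₀ then 0 else 1)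
  canonical-A k<LA rewrite <⇒<ᵇ≡true k<LA = refl

  canonical-B : ∀ {a₀ p₀ β} → β < LB → canonical a₀ p₀ (LA + β) ≡ (if β ≡ᵇ p₀ then 0 else 2)
  canonical-B {β = β} β<LB
    rewrite ≥⇒<ᵇ≡false (m≤m+n LA β) | <⇒<ᵇ≡true (+-monoʳ-< LA β<LB) | m+n∸m≡n LA β = refl

  canonical-W : ∀ {a₀ p₀ q} → q < LW → canonical a₀ p₀ (OA + q) ≡ 1
  canonical-W {q = q} q<LW
    rewrite ≥⇒<ᵇ≡false (LA≤OA+ q) | ≥⇒<ᵇ≡false (m≤m+n OA q) | <⇒<ᵇ≡true (+-monoʳ-< OA q<LW) = refl

  canonical-W′ : ∀ {a₀ p₀ β} → β < LB → canonical a₀ p₀ (OB + β) ≡ 2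
  canonical-W′ {β = β} β<LB
    rewrite ≥⇒<ᵇ≡false (≤-trans (m≤m+n LA LB) (OA≤OB+ β)) | ≥⇒<ᵇ≡false (OA≤OB+ β)
          | ≥⇒<ᵇ≡false (m≤m+n OB β) | <⇒<ᵇ≡true (+-monoʳ-< OB β<LB) = refl

  canonical-a₀ : ∀ {a₀ p₀} → a₀ < LA → canonical a₀ p₀ a₀ ≡ 0
  canonical-a₀ {a₀} a₀<LA = trans (canonical-A a₀<LA) (cong (λ b → if b then 0 else 1) (≡ᵇ-refl a₀))

  canonical-A∖a₀ : ∀ {a₀ p₀ a} → a < LA → a ≢ a₀ → canonical a₀ p₀ a ≡ 1
  canonical-A∖a₀ a<LA a≢a₀ = trans (canonical-A a<LA) (cong (λ b → if b then 0 else 1) (≢⇒≡ᵇ≡false a≢a₀))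

  canonical-B∖p₀ : ∀ {a₀ p₀ β} → β < LB → β ≢ p₀ → canonical a₀ p₀ (LA + β) ≡ 2
  canonical-B∖p₀ β<LB β≢p₀ = trans (canonical-B β<LB) (cong (λ b → if b then 0 else 2) (≢⇒≡ᵇ≡false β≢p₀))

  canonical-B≢1 : ∀ {a₀ p₀ β} → β < LB → (canonical a₀ p₀ (LA + β) ≡ᵇ 1) ≡ false
  canonical-B≢1 {a₀} {p₀} {β} β<LB = trans (cong (_≡ᵇ 1) (canonical-B {a₀} {p₀} β<LB)) (0or2≢1 (β ≡ᵇ p₀))
    where
    0or2≢1 : ∀ b → ((if b then 0 else 2) ≡ᵇ 1) ≡ false
    0or2≢1 true  = refl
    0or2≢1 false = refl

  aliceEdge-AB : ∀ {a β} → a < LA → β < LB → aliceEdge a (LA + β) ≡ true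
  aliceEdge-AB {β = β} a<LA β<LB
    rewrite <⇒<ᵇ≡true a<LA | ≥⇒<ᵇ≡false (m≤m+n LA β) | <⇒<ᵇ≡true (+-monoʳ-< LA β<LB) = refl

  aliceEdge-fromOutsideA : ∀ {i} j → LA ≤ i → aliceEdge i j ≡ false
  aliceEdge-fromOutsideA j LA≤i rewrite ≥⇒<ᵇ≡false LA≤i = refl

  aliceEdge-intoA : ∀ i {j} → j < LA → aliceEdge i j ≡ false
  aliceEdge-intoA i j<LA rewrite <⇒<ᵇ≡true j<LA with i <ᵇ LA
  ... | true  = refl
  ... | false = refl

  aliceEdge-beyondB : ∀ i {j} → OA ≤ j → aliceEdge i j ≡ false
  aliceEdge-beyondB i {j} OA≤j rewrite ≥⇒<ᵇ≡false OA≤j with i <ᵇ LA | j <ᵇ LA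
  ... | true  | true  = refl
  ... | true  | false = refl
  ... | false | _     = refl

  aliceLabel-column : ∀ X a {p} → p < v → aliceLabel X a (LA + p) ≡ X a p
  aliceLabel-column X a {p} p<v rewrite m+n∸m≡n LA p | <⇒<ᵇ≡true p<v = refl

  aliceLabel-complement : ∀ X a p → aliceLabel X a (LA + (v + p)) ≡ not (X a p)
  aliceLabel-complement X a p rewrite m+n∸m≡n LA (v + p) | ≥⇒<ᵇ≡false (m≤m+n v p) | m+n∸m≡n v p = refl

  indicator+indicator-not : ∀ b → indicator b + indicator (not b) ≡ 1
  indicator+indicator-not true  = refl
  indicator+indicator-not false = refl

  aliceLabel-count : ∀ X a → sum< LB (λ β → indicator (aliceLabel X a (LA + β))) ≡ v
  aliceLabel-count X a = begin
    sum< LB (λ β → indicator (aliceLabel X a (LA + β)))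
      ≡⟨ sum<-+ v v _ ⟩
    sum< v (λ p → indicator (aliceLabel X a (LA + p))) + sum< v (λ p → indicator (aliceLabel X a (LA + (v + p))))
      ≡⟨ cong₂ _+_ (sum<-cong v (λ p p<v → cong indicator (aliceLabel-column X a p<v)))
                   (sum<-cong v (λ p _ → cong indicator (aliceLabel-complement X a p))) ⟩
    sum< v (λ p → indicator (X a p)) + sum< v (λ p → indicator (not (X a p)))
      ≡⟨ sym (sum<-distrib-+ v _ _) ⟩
    sum< v (λ p → indicator (X a p) + indicator (not (X a p)))
      ≡⟨ sum<-cong v (λ p _ → indicator+indicator-not (X a p)) ⟩
    sum< v (λ _ → 1)
      ≡⟨ trans (sum<-const v 1) (*-identityʳ v) ⟩
    v ∎
    where open ≡-Reasoning

  blocks≤sum<TOT : ∀ F → sum< LB (λ β → F (LA + β)) + sum< LW (λ q → F (OA + q)) + sum< LB (λ β → F (OB + β))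
                         ≤ sum< TOT F
  blocks≤sum<TOT F = begin
    sum< LB (λ β → F (LA + β)) + sum< LW (λ q → F (OA + q)) + sum< LB (λ β → F (OB + β))
      ≤⟨ +-monoˡ-≤ _ (+-monoˡ-≤ _ (m≤n+m _ (sum< LA F))) ⟩
    sum< LA F + sum< LB (λ β → F (LA + β)) + sum< LW (λ q → F (OA + q)) + sum< LB (λ β → F (OB + β))
      ≡⟨ cong (λ z → z + sum< LW (λ q → F (OA + q)) + sum< LB (λ β → F (OB + β))) (sym (sum<-+ LA LB F)) ⟩
    sum< OA F + sum< LW (λ q → F (OA + q)) + sum< LB (λ β → F (OB + β))
      ≡⟨ cong (_+ sum< LB (λ β → F (OB + β))) (sym (sum<-+ OA LW F)) ⟩
    sum< OB F + sum< LB (λ β → F (OB + β))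
      ≡⟨ sym (sum<-+ OB LB F) ⟩
    sum< TOT F ∎
    where open ≤-Reasoning

  module LowerBound (X : ℕ → ℕ → Bool) (a₀ p₀ n : ℕ) (TOT≤n : TOT ≤ n) (K : ℕ → ℕ) where

    sg : ℕ → ℕ → Bool
    sg = label X a₀ p₀

    pcost : ℕ → ℕ → ℕ
    pcost = pairCost sg K

    triangle : ∀ i j k → sg i j ≡ true → sg i k ≡ true → sg j k ≡ false →
               1 ≤ pcost i j + pcost i k + pcost j k
    triangle i j k ij ik jk rewrite ij | ik | jk = badTriangle (K i) (K j) (K k)

    triangle′ : ∀ i j k → sg i j ≡ true → sg i k ≡ false → sg j k ≡ true →
                1 ≤ pcost i j + pcost i k + pcost j k
    triangle′ i j k ij ik jk rewrite ij | ik | jk = badTriangle′ (K i) (K j) (K k)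

    sg-AB : ∀ {a β} → a < LA → β < LB → sg a (LA + β) ≡ aliceLabel X a (LA + β)
    sg-AB a<LA β<LB rewrite aliceEdge-AB a<LA β<LB = refl

    sg-beyondB : ∀ i {j} → OA ≤ j → sg i j ≡ (canonical a₀ p₀ i ≡ᵇ canonical a₀ p₀ j)
    sg-beyondB i OA≤j rewrite aliceEdge-beyondB i OA≤j = refl

    AB AW AW′ BW BW′ : ℕ → ℕ
    AB  a = sum< LB (λ β → pcost a (LA + β))
    AW  a = sum< LB (λ β → pcost a (OA + (a + β)))
    AW′ a = sum< LB (λ β → pcost a (OB + β))
    BW  β = sum< LA (λ a → pcost (LA + β) (OA + (β + a)))
    BW′ β = pcost (LA + β) (OB + β)

    triangle-A∖a₀ : ∀ a β → a < LA → β < LB → a ≢ a₀ →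
                    indicator (aliceLabel X a (LA + β)) ≤ pcost a (LA + β) + pcost a (OA + (a + β)) + pcost (LA + β) (OA + (a + β))
    triangle-A∖a₀ a β a<LA β<LB a≢a₀ =
      indicator≤ _ (λ ab → triangle a (LA + β) (OA + (a + β)) (trans (sg-AB a<LA β<LB) ab) aw bw)
      where
      a+β<LW : a + β < LW
      a+β<LW = +-mono-< a<LA β<LB
      aw : sg a (OA + (a + β)) ≡ true
      aw = trans (sg-beyondB a (m≤m+n OA (a + β)))
                 (cong₂ _≡ᵇ_ (canonical-A∖a₀ a<LA a≢a₀) (canonical-W a+β<LW))
      bw : sg (LA + β) (OA + (a + β)) ≡ false
      bw = trans (sg-beyondB (LA + β) (m≤m+n OA (a + β)))
                 (trans (cong (canonical a₀ p₀ (LA + β) ≡ᵇ_) (canonical-W a+β<LW)) (canonical-B≢1 β<LB))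

    triangle-a₀ : a₀ < LA → p₀ < v → X a₀ p₀ ≡ false → ∀ β → β < LB →
                  indicator (aliceLabel X a₀ (LA + β)) ≤ pcost a₀ (LA + β) + pcost a₀ (OB + β) + pcost (LA + β) (OB + β)
    triangle-a₀ a₀<LA p₀<v bit≡false β β<LB =
      indicator≤ _ (λ ab → triangle′ a₀ (LA + β) (OB + β) (trans (sg-AB a₀<LA β<LB) ab) aw′ (bw′ (β≢p₀ ab)))
      where
      β≢p₀ : aliceLabel X a₀ (LA + β) ≡ true → β ≢ p₀
      β≢p₀ ab refl with trans (sym ab) (trans (aliceLabel-column X a₀ p₀<v) bit≡false)
      ... | ()
      aw′ : sg a₀ (OB + β) ≡ false
      aw′ = trans (sg-beyondB a₀ (OA≤OB+ β)) (cong₂ _≡ᵇ_ (canonical-a₀ a₀<LA) (canonical-W′ β<LB))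
      bw′ : β ≢ p₀ → sg (LA + β) (OB + β) ≡ true
      bw′ β≢p₀ = trans (sg-beyondB (LA + β) (OA≤OB+ β))
                  (trans (cong₂ _≡ᵇ_ (canonical-B∖p₀ β<LB β≢p₀) (canonical-W′ β<LB)) refl)

    blocks≤rowCost : ∀ i → i < OA →
      sum< LB (λ β → onlyIf (i <ᵇ LA + β) (pcost i (LA + β))) + sum< LW (λ q → pcost i (OA + q)) + sum< LB (λ β → pcost i (OB + β))
        ≤ rowCost n pcost i
    blocks≤rowCost i i<OA = begin
      sum< LB (λ β → onlyIf (i <ᵇ LA + β) (pcost i (LA + β))) + sum< LW (λ q → pcost i (OA + q)) + sum< LB (λ β → pcost i (OB + β))
        ≡⟨ sym (cong₂ (λ w w′ → sum< LB (λ β → onlyIf (i <ᵇ LA + β) (pcost i (LA + β))) + w + w′)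
                      (above OA LW i<OA) (above OB LB (≤-trans i<OA (m≤m+n OA LW)))) ⟩
      _ ≤⟨ blocks≤sum<TOT (λ j → onlyIf (i <ᵇ j) (pcost i j)) ⟩
      sum< TOT (λ j → onlyIf (i <ᵇ j) (pcost i j))
        ≤⟨ window≤sum< 0 TOT n _ TOT≤n ⟩
      rowCost n pcost i ∎
      where
      open ≤-Reasoning
      above : ∀ s l → i < s → sum< l (λ k → onlyIf (i <ᵇ s + k) (pcost i (s + k))) ≡ sum< l (λ k → pcost i (s + k))
      above s l i<s = sum<-cong l (λ k _ → onlyIf-true _ (<⇒<ᵇ≡true (≤-trans i<s (m≤m+n s k))))

    rowCost-A : ∀ a → a < LA → AB a + AW a + AW′ a ≤ rowCost n pcost a
    rowCost-A a a<LA = begin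
      AB a + AW a + AW′ a
        ≤⟨ +-monoˡ-≤ (AW′ a) (+-monoʳ-≤ (AB a) (window≤sum< a LB LW _ (+-monoˡ-≤ LB (<⇒≤ a<LA)))) ⟩
      AB a + sum< LW (λ q → pcost a (OA + q)) + AW′ a
        ≡⟨ cong (λ z → z + sum< LW (λ q → pcost a (OA + q)) + AW′ a)
                (sym (sum<-cong LB (λ β _ → onlyIf-true _ (<⇒<ᵇ≡true (≤-trans a<LA (m≤m+n LA β)))))) ⟩
      _ ≤⟨ blocks≤rowCost a (≤-trans a<LA (m≤m+n LA LB)) ⟩
      rowCost n pcost a ∎
      where open ≤-Reasoning

    rowCost-B : ∀ β → β < LB → BW β + BW′ β ≤ rowCost n pcost (LA + β)
    rowCost-B β β<LB = begin
      BW β + BW′ β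
        ≤⟨ +-mono-≤ (window≤sum< β LA LW _ (subst (β + LA ≤_) (+-comm LB LA) (+-monoˡ-≤ LA (<⇒≤ β<LB))))
                    (term≤sum< LB (λ β′ → pcost (LA + β) (OB + β′)) β β<LB) ⟩
      sum< LW (λ q → pcost (LA + β) (OA + q)) + sum< LB (λ β′ → pcost (LA + β) (OB + β′))
        ≤⟨ +-monoˡ-≤ _ (m≤n+m _ (sum< LB (λ β′ → onlyIf (LA + β <ᵇ LA + β′) (pcost (LA + β) (LA + β′))))) ⟩
      _ ≤⟨ blocks≤rowCost (LA + β) (+-monoʳ-< LA β<LB) ⟩
      rowCost n pcost (LA + β) ∎
      where open ≤-Reasoning

    rowSums≤upperSum : sum< LA (λ a → AB a + AW a + AW′ a) + sum< LB (λ β → BW β + BW′ β) ≤ upperSum n pcost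
    rowSums≤upperSum = begin
      sum< LA (λ a → AB a + AW a + AW′ a) + sum< LB (λ β → BW β + BW′ β)
        ≤⟨ +-mono-≤ (sum<-mono-≤ LA rowCost-A) (sum<-mono-≤ LB rowCost-B) ⟩
      sum< LA (rowCost n pcost) + sum< LB (λ β → rowCost n pcost (LA + β))
        ≡⟨ sym (sum<-+ LA LB (rowCost n pcost)) ⟩
      sum< OA (rowCost n pcost)
        ≤⟨ window≤sum< 0 OA n _ (≤-trans OA≤TOT TOT≤n) ⟩
      upperSum n pcost ∎
      where open ≤-Reasoning

    -- Every + edge a–(LA + β) of A × B lies in the bad triangle with OA + (a + β) (for a ≢ a₀) or with
    -- OB + β (for a = a₀); these triangles are pairwise edge-disjoint, and each row of A has v + edges.
    triangles≤rowSums : a₀ < LA → p₀ < v → X a₀ p₀ ≡ false →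
                        LA * v ≤ sum< LA (λ a → AB a + AW a + AW′ a) + sum< LB (λ β → BW β + BW′ β)
    triangles≤rowSums a₀<LA p₀<v bit≡false = begin
      LA * v
        ≡⟨ sym (sum<-const LA v) ⟩
      sum< LA (λ _ → v)
        ≤⟨ sum<-mono-≤-except LA (λ a → AB a + AW a + BA a) (λ _ → v) E a₀ a₀<LA rows-A∖a₀ row-a₀ ⟩
      sum< LA (λ a → AB a + AW a + BA a) + E
        ≡⟨ cong (_+ E) (trans (sum<-distrib-+ LA (λ a → AB a + AW a) BA) (cong (sum< LA (λ a → AB a + AW a) +_) ΣBA≡ΣBW)) ⟩
      sum< LA (λ a → AB a + AW a) + sum< LB BW + (AW′ a₀ + sum< LB BW′)
        ≤⟨ +-monoʳ-≤ (sum< LA (λ a → AB a + AW a) + sum< LB BW) (+-monoˡ-≤ (sum< LB BW′) (term≤sum< LA AW′ a₀ a₀<LA)) ⟩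
      sum< LA (λ a → AB a + AW a) + sum< LB BW + (sum< LA AW′ + sum< LB BW′)
        ≡⟨ +-interchange (sum< LA (λ a → AB a + AW a)) (sum< LB BW) (sum< LA AW′) (sum< LB BW′) ⟩
      sum< LA (λ a → AB a + AW a) + sum< LA AW′ + (sum< LB BW + sum< LB BW′)
        ≡⟨ sym (cong₂ _+_ (sum<-distrib-+ LA (λ a → AB a + AW a) AW′) (sum<-distrib-+ LB BW BW′)) ⟩
      sum< LA (λ a → AB a + AW a + AW′ a) + sum< LB (λ β → BW β + BW′ β) ∎
      where
      open ≤-Reasoning
      BA : ℕ → ℕ
      BA a = sum< LB (λ β → pcost (LA + β) (OA + (a + β)))
      E : ℕ
      E = AW′ a₀ + sum< LB BW′
      ΣBA≡ΣBW : sum< LA BA ≡ sum< LB BW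
      ΣBA≡ΣBW = trans (sum<-comm LA LB (λ a β → pcost (LA + β) (OA + (a + β))))
                      (sum<-cong LB (λ β _ → sum<-cong LA (λ a _ → cong (λ t → pcost (LA + β) (OA + t)) (+-comm a β))))
      rows-A∖a₀ : ∀ a → a < LA → a ≢ a₀ → v ≤ AB a + AW a + BA a
      rows-A∖a₀ a a<LA a≢a₀ = begin
        v ≡⟨ sym (aliceLabel-count X a) ⟩
        sum< LB (λ β → indicator (aliceLabel X a (LA + β)))
          ≤⟨ sum<-mono-≤ LB (λ β β<LB → triangle-A∖a₀ a β a<LA β<LB a≢a₀) ⟩
        sum< LB (λ β → pcost a (LA + β) + pcost a (OA + (a + β)) + pcost (LA + β) (OA + (a + β)))
          ≡⟨ sum<-distrib-+₃ LB _ _ _ ⟩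
        AB a + AW a + BA a ∎
      row-a₀ : v ≤ AB a₀ + AW a₀ + BA a₀ + E
      row-a₀ = begin
        v ≡⟨ sym (aliceLabel-count X a₀) ⟩
        sum< LB (λ β → indicator (aliceLabel X a₀ (LA + β)))
          ≤⟨ sum<-mono-≤ LB (triangle-a₀ a₀<LA p₀<v bit≡false) ⟩
        sum< LB (λ β → pcost a₀ (LA + β) + pcost a₀ (OB + β) + BW′ β)
          ≡⟨ trans (sum<-distrib-+₃ LB _ _ _) (+-assoc (AB a₀) (AW′ a₀) (sum< LB BW′)) ⟩
        AB a₀ + E
          ≤⟨ +-monoˡ-≤ E (≤-trans (m≤m+n (AB a₀) (AW a₀)) (m≤m+n _ (BA a₀))) ⟩
        AB a₀ + AW a₀ + BA a₀ + E ∎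

    everyClustering≥ : a₀ < LA → p₀ < v → X a₀ p₀ ≡ false → LA * v ≤ upperSum n pcost
    everyClustering≥ a₀<LA p₀<v bit≡false = ≤-trans (triangles≤rowSums a₀<LA p₀<v bit≡false) rowSums≤upperSum

  module UpperBound (X : ℕ → ℕ → Bool) (a₀ p₀ : ℕ) (a₀<LA : a₀ < LA) (p₀<v : p₀ < v) (bit≡true : X a₀ p₀ ≡ true) where

    cluster : ℕ → ℕ
    cluster = canonical a₀ p₀

    aliceCost : ℕ → ℕ → ℕ
    aliceCost i j = onlyIf (aliceEdge i j) (mismatch (aliceLabel X i j) (cluster i ≡ᵇ cluster j))

    mismatch-self : ∀ b → mismatch b b ≡ 0
    mismatch-self true  = refl
    mismatch-self false = refl

    pairCost≤aliceCost : ∀ i j → onlyIf (i <ᵇ j) (pairCost (label X a₀ p₀) cluster i j) ≤ aliceCost i j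
    pairCost≤aliceCost i j with aliceEdge i j
    ... | true  = onlyIf≤ _ _
    ... | false = ≤-trans (onlyIf≤ _ _) (≤-reflexive (mismatch-self (cluster i ≡ᵇ cluster j)))

    aliceCost-off : ∀ i j → aliceEdge i j ≡ false → aliceCost i j ≡ 0
    aliceCost-off i j off = cong (λ b → onlyIf b (mismatch (aliceLabel X i j) (cluster i ≡ᵇ cluster j))) off

    aliceCost-on : ∀ i j → aliceEdge i j ≡ true → aliceCost i j ≡ mismatch (aliceLabel X i j) (cluster i ≡ᵇ cluster j)
    aliceCost-on i j on = cong (λ b → onlyIf b (mismatch (aliceLabel X i j) (cluster i ≡ᵇ cluster j))) on

    sum-aliceCost : ∀ n → OA ≤ n →
                    sum< n (λ i → sum< n (aliceCost i)) ≡ sum< LA (λ a → sum< LB (λ β → aliceCost a (LA + β)))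
    sum-aliceCost n OA≤n with m≤n⇒∃[o]m+o≡n (≤-trans (m≤m+n LA LB) OA≤n)
    ... | r , refl = trans (sum<-cong (LA + r) (λ i _ → row i))
                           (sum<-+-zeroʳ LA r _ (λ k _ → sum<-zero LB _ (λ β _ →
                              aliceCost-off (LA + k) (LA + β) (aliceEdge-fromOutsideA (LA + β) (m≤m+n LA k)))))
      where
      row : ∀ i → sum< (LA + r) (aliceCost i) ≡ sum< LB (λ β → aliceCost i (LA + β))
      row i with m≤n⇒∃[o]m+o≡n OA≤n
      ... | s , eq = begin
        sum< (LA + r) (aliceCost i)
          ≡⟨ cong (λ m → sum< m (aliceCost i)) (sym eq) ⟩
        sum< (OA + s) (aliceCost i)
          ≡⟨ sum<-+-zeroʳ OA s (aliceCost i) (λ k _ → aliceCost-off i (OA + k) (aliceEdge-beyondB i (m≤m+n OA k))) ⟩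
        sum< OA (aliceCost i)
          ≡⟨ sum<-+ LA LB (aliceCost i) ⟩
        sum< LA (aliceCost i) + sum< LB (λ β → aliceCost i (LA + β))
          ≡⟨ cong (_+ sum< LB (λ β → aliceCost i (LA + β))) (sum<-zero LA (aliceCost i) (λ k k<LA → aliceCost-off i k (aliceEdge-intoA i k<LA))) ⟩
        sum< LB (λ β → aliceCost i (LA + β)) ∎
        where open ≡-Reasoning

    columnPairCost : ℕ → ℕ → ℕ
    columnPairCost a p = mismatch (X a p) (cluster a ≡ᵇ cluster (LA + p)) + mismatch (not (X a p)) (cluster a ≡ᵇ cluster (LA + (v + p)))

    p<LB : ∀ {p} → p < v → p < LB
    p<LB p<v = ≤-trans p<v (m≤m+n v v)

    cluster-complement : ∀ p → p < v → cluster (LA + (v + p)) ≡ 2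
    cluster-complement p p<v = canonical-B∖p₀ (+-monoʳ-< v p<v) (λ v+p≡p₀ → <⇒≱ p₀<v (≤-trans (m≤m+n v p) (≤-reflexive v+p≡p₀)))

    cluster-A≢2 : ∀ a → a < LA → (cluster a ≡ᵇ 2) ≡ false
    cluster-A≢2 a a<LA with a ≟ a₀
    ... | yes refl rewrite canonical-a₀ {p₀ = p₀} a₀<LA = refl
    ... | no a≢a₀  rewrite canonical-A∖a₀ {p₀ = p₀} a<LA a≢a₀ = refl

    sameCluster⇒bit : ∀ a p → a < LA → p < v → (cluster a ≡ᵇ cluster (LA + p)) ≡ true → X a p ≡ true
    sameCluster⇒bit a p a<LA p<v same with a ≟ a₀ | p ≟ p₀
    ... | yes refl | yes refl = bit≡true
    ... | yes refl | no p≢p₀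
      rewrite canonical-a₀ {p₀ = p₀} a₀<LA | canonical-B∖p₀ {a₀} (p<LB p<v) p≢p₀ with () ← same
    ... | no a≢a₀  | _
      rewrite canonical-A∖a₀ {p₀ = p₀} a<LA a≢a₀ | canonical-B {a₀} {p₀} (p<LB p<v) with p ≡ᵇ p₀
    ...   | true  with () ← same
    ...   | false with () ← same

    columnPairCost≤1 : ∀ a p → a < LA → p < v → columnPairCost a p ≤ 1
    columnPairCost≤1 a p a<LA p<v rewrite cluster-complement p p<v | cluster-A≢2 a a<LA =
      atMostOne (X a p) _ (sameCluster⇒bit a p a<LA p<v)
      where
      atMostOne : ∀ x s → (s ≡ true → x ≡ true) → mismatch x s + mismatch (not x) false ≤ 1
      atMostOne true  true  _     = z≤n
      atMostOne true  false _     = ≤-refl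
      atMostOne false false _     = ≤-refl
      atMostOne false true  s⇒x with () ← s⇒x refl

    columnPairCost-a₀p₀ : columnPairCost a₀ p₀ ≡ 0
    columnPairCost-a₀p₀ rewrite cluster-complement p₀ p₀<v | canonical-a₀ {p₀ = p₀} a₀<LA
                              | canonical-B {a₀} {p₀} (p<LB p₀<v) | ≡ᵇ-refl p₀ | bit≡true = refl

    aliceRow≡columnPairs : ∀ a → a < LA → sum< LB (λ β → aliceCost a (LA + β)) ≡ sum< v (columnPairCost a)
    aliceRow≡columnPairs a a<LA = begin
      sum< LB (λ β → aliceCost a (LA + β))
        ≡⟨ sum<-+ v v _ ⟩
      sum< v (λ p → aliceCost a (LA + p)) + sum< v (λ p → aliceCost a (LA + (v + p)))
        ≡⟨ cong₂ _+_ (sum<-cong v column) (sum<-cong v complement) ⟩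
      sum< v (λ p → mismatch (X a p) (cluster a ≡ᵇ cluster (LA + p)))
        + sum< v (λ p → mismatch (not (X a p)) (cluster a ≡ᵇ cluster (LA + (v + p))))
        ≡⟨ sym (sum<-distrib-+ v _ _) ⟩
      sum< v (columnPairCost a) ∎
      where
      open ≡-Reasoning
      column : ∀ p → p < v → aliceCost a (LA + p) ≡ mismatch (X a p) (cluster a ≡ᵇ cluster (LA + p))
      column p p<v = trans (aliceCost-on a (LA + p) (aliceEdge-AB a<LA (p<LB p<v)))
                           (cong (λ s → mismatch s (cluster a ≡ᵇ cluster (LA + p))) (aliceLabel-column X a p<v))
      complement : ∀ p → p < v → aliceCost a (LA + (v + p)) ≡ mismatch (not (X a p)) (cluster a ≡ᵇ cluster (LA + (v + p)))
      complement p p<v = trans (aliceCost-on a (LA + (v + p)) (aliceEdge-AB a<LA (+-monoʳ-< v p<v)))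
                               (cong (λ s → mismatch s (cluster a ≡ᵇ cluster (LA + (v + p)))) (aliceLabel-complement X a p))

    canonicalCost< : ∀ n → OA ≤ n → upperSum n (pairCost (label X a₀ p₀) cluster) < LA * v
    canonicalCost< n OA≤n = begin-strict
      upperSum n (pairCost (label X a₀ p₀) cluster)
        ≤⟨ sum<-mono-≤ n (λ i _ → sum<-mono-≤ n (λ j _ → pairCost≤aliceCost i j)) ⟩
      sum< n (λ i → sum< n (aliceCost i))
        ≡⟨ sum-aliceCost n OA≤n ⟩
      sum< LA (λ a → sum< LB (λ β → aliceCost a (LA + β)))
        ≡⟨ sum<-cong LA aliceRow≡columnPairs ⟩
      sum< LA (λ a → sum< v (columnPairCost a))
        <⟨ sum<<n*c LA v _ a₀ a₀<LA row≤v row-a₀<v ⟩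
      LA * v ∎
      where
      open ≤-Reasoning
      row≤v : ∀ a → a < LA → sum< v (columnPairCost a) ≤ v
      row≤v a a<LA = subst (sum< v (columnPairCost a) ≤_) (*-identityʳ v) (sum<≤n*c v 1 _ (λ p p<v → columnPairCost≤1 a p a<LA p<v))
      row-a₀<v : sum< v (columnPairCost a₀) < v
      row-a₀<v = subst (sum< v (columnPairCost a₀) <_) (*-identityʳ v)
        (sum<<n*c v 1 _ p₀ p₀<v (λ p p<v → columnPairCost≤1 a₀ p a₀<LA p<v) (subst (_< 1) (sym columnPairCost-a₀p₀) z<s))

  labeling : ∀ {n} → (ℕ → ℕ → Bool) → ℕ → ℕ → Labeling n
  labeling X a₀ p₀ i j = label X a₀ p₀ (toℕ i) (toℕ j)

  module _ (a₀ p₀ n : ℕ) (3≤n : 3 ≤ n) where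

    canonical<n : ∀ k → k < n → canonical a₀ p₀ k < n
    canonical<n k k<n =
      cases (k <ᵇ LA) (k ≡ᵇ a₀) (k <ᵇ OA) ((k ∸ LA) ≡ᵇ p₀) (k <ᵇ OB) (k <ᵇ TOT)
      where
      cases : ∀ b₁ b₂ b₃ b₄ b₅ b₆ →
              (if b₁ then (if b₂ then 0 else 1) else if b₃ then (if b₄ then 0 else 2)
               else if b₅ then 1 else if b₆ then 2 else k) < n
      cases true  true  _     _     _     _     = ≤-trans (s≤s z≤n) 3≤n
      cases true  false _     _     _     _     = ≤-trans (s≤s (s≤s z≤n)) 3≤n
      cases false _     true  true  _     _     = ≤-trans (s≤s z≤n) 3≤n
      cases false _     true  false _     _     = 3≤n
      cases false _     false _     true  _     = ≤-trans (s≤s (s≤s z≤n)) 3≤n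
      cases false _     false _     false true  = 3≤n
      cases false _     false _     false false = k<n

    canonicalClustering : Clustering n
    canonicalClustering i = fromℕ< (canonical<n (toℕ i) (toℕ<n i))

    clusterIndex-canonical : ∀ k → k < n → clusterIndex canonicalClustering k ≡ canonical a₀ p₀ k
    clusterIndex-canonical k k<n with k <? n
    ... | yes k<n′ = trans (toℕ-fromℕ< _) (cong (canonical a₀ p₀) (toℕ-fromℕ< k<n′))
    ... | no  k≮n  = ⊥-elim (k≮n k<n)

    optimalCost-decodes : ∀ X → TOT ≤ n → a₀ < LA → p₀ < v → ∀ opt → IsOptCost (labeling X a₀ p₀) opt →
                          (opt <ᵇ LA * v) ≡ X a₀ p₀
    optimalCost-decodes X TOT≤n a₀<LA p₀<v opt ((c , cost≡opt) , opt≤) with X a₀ p₀ in bit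
    ... | true  = <⇒<ᵇ≡true (begin-strict
      opt
        ≤⟨ opt≤ canonicalClustering ⟩
      cost (labeling X a₀ p₀) canonicalClustering
        ≡⟨ cost≡upperSum n (label X a₀ p₀) canonicalClustering ⟩
      upperSum n (pairCost (label X a₀ p₀) (clusterIndex canonicalClustering))
        ≡⟨ sum<-cong n (λ i i<n → sum<-cong n (λ j j<n →
             cong₂ (λ p q → onlyIf (i <ᵇ j) (mismatch (label X a₀ p₀ i j) (p ≡ᵇ q)))
                   (clusterIndex-canonical i i<n) (clusterIndex-canonical j j<n))) ⟩
      upperSum n (pairCost (label X a₀ p₀) (canonical a₀ p₀))
        <⟨ UpperBound.canonicalCost< X a₀ p₀ a₀<LA p₀<v bit n (≤-trans OA≤TOT TOT≤n) ⟩
      LA * v ∎)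
      where open ≤-Reasoning
    ... | false = ≥⇒<ᵇ≡false (begin
      LA * v
        ≤⟨ LowerBound.everyClustering≥ X a₀ p₀ n TOT≤n (clusterIndex c) a₀<LA p₀<v bit ⟩
      upperSum n (pairCost (label X a₀ p₀) (clusterIndex c))
        ≡⟨ sym (cost≡upperSum n (label X a₀ p₀) c) ⟩
      cost (labeling X a₀ p₀) c
        ≡⟨ cost≡opt ⟩
      opt ∎)
      where open ≤-Reasoning

∑-mono-≤ : ∀ {k} {f g : Fin k → ℕ} → (∀ i → f i ≤ g i) → ∑[ i < k ] f i ≤ ∑[ i < k ] g i
∑-mono-≤ {zero}  f≤g = z≤n
∑-mono-≤ {suc k} f≤g = +-mono-≤ (f≤g Fin.zero) (∑-mono-≤ (f≤g ∘ Fin.suc))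

∑-const : ∀ k c → ∑[ i < k ] c ≡ k * c
∑-const zero    c = refl
∑-const (suc k) c = cong (c +_) (∑-const k c)

term≤∑ : ∀ {k} (f : Fin k → ℕ) i → f i ≤ ∑[ j < k ] f j
term≤∑ {suc k} f Fin.zero    = m≤m+n _ _
term≤∑ {suc k} f (Fin.suc i) = ≤-trans (term≤∑ (f ∘ Fin.suc) i) (m≤n+m _ _)

sumAll : ∀ m → ((Fin m → Bool) → ℕ) → ℕ
sumAll zero    F = F (λ ())
sumAll (suc m) F = sumAll m (λ x → F (false Vector.∷ x)) + sumAll m (λ x → F (true Vector.∷ x))

sumAll-mono-≤ : ∀ m {F G : (Fin m → Bool) → ℕ} → (∀ x → F x ≤ G x) → sumAll m F ≤ sumAll m G
sumAll-mono-≤ zero    F≤G = F≤G _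
sumAll-mono-≤ (suc m) F≤G = +-mono-≤ (sumAll-mono-≤ m (λ x → F≤G _)) (sumAll-mono-≤ m (λ x → F≤G _))

sumAll-cong : ∀ m {F G : (Fin m → Bool) → ℕ} → (∀ x → F x ≡ G x) → sumAll m F ≡ sumAll m G
sumAll-cong zero    F≡G = F≡G _
sumAll-cong (suc m) F≡G = cong₂ _+_ (sumAll-cong m (λ x → F≡G _)) (sumAll-cong m (λ x → F≡G _))

sumAll-distrib-+ : ∀ m F G → sumAll m (λ x → F x + G x) ≡ sumAll m F + sumAll m G
sumAll-distrib-+ zero    F G = refl
sumAll-distrib-+ (suc m) F G =
  trans (cong₂ _+_ (sumAll-distrib-+ m (λ x → F (false Vector.∷ x)) (λ x → G (false Vector.∷ x)))
                   (sumAll-distrib-+ m (λ x → F (true Vector.∷ x)) (λ x → G (true Vector.∷ x))))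
        (+-interchange (sumAll m (λ x → F (false Vector.∷ x))) (sumAll m (λ x → G (false Vector.∷ x)))
                     (sumAll m (λ x → F (true Vector.∷ x))) (sumAll m (λ x → G (true Vector.∷ x))))

sumAll-*-distribˡ : ∀ m k F → sumAll m (λ x → k * F x) ≡ k * sumAll m F
sumAll-*-distribˡ zero    k F = refl
sumAll-*-distribˡ (suc m) k F =
  trans (cong₂ _+_ (sumAll-*-distribˡ m k (λ x → F (false Vector.∷ x))) (sumAll-*-distribˡ m k (λ x → F (true Vector.∷ x))))
        (sym (*-distribˡ-+ k _ _))

sumAll-const : ∀ m c → sumAll m (λ _ → c) ≡ 2 ^ m * c
sumAll-const zero    c = sym (+-identityʳ c)
sumAll-const (suc m) c = begin
  sumAll m (λ _ → c) + sumAll m (λ _ → c) ≡⟨ cong₂ _+_ (sumAll-const m c) (sumAll-const m c) ⟩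
  2 ^ m * c + 2 ^ m * c                   ≡⟨ cong (2 ^ m * c +_) (sym (+-identityʳ (2 ^ m * c))) ⟩
  2 * (2 ^ m * c)                         ≡⟨ sym (*-assoc 2 (2 ^ m) c) ⟩
  2 ^ suc m * c                           ∎
  where open ≡-Reasoning

sumAll-∑-comm : ∀ m k (F : (Fin m → Bool) → Fin k → ℕ) →
                sumAll m (λ x → ∑[ i < k ] F x i) ≡ ∑[ i < k ] sumAll m (λ x → F x i)
sumAll-∑-comm zero    k F = refl
sumAll-∑-comm (suc m) k F =
  trans (cong₂ _+_ (sumAll-∑-comm m k (λ x → F (false Vector.∷ x))) (sumAll-∑-comm m k (λ x → F (true Vector.∷ x))))
        (sym (∑-distrib-+ (λ i → sumAll m (λ x → F (false Vector.∷ x) i)) (λ i → sumAll m (λ x → F (true Vector.∷ x) i))))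

agree : Bool → Bool → ℕ
agree true  true  = 1
agree false false = 1
agree true  false = 0
agree false true  = 0

agree-refl : ∀ b → agree b b ≡ 1
agree-refl true  = refl
agree-refl false = refl

agree≤1 : ∀ a b → agree a b ≤ 1
agree≤1 true  true  = ≤-refl
agree≤1 false false = ≤-refl
agree≤1 true  false = z≤n
agree≤1 false true  = z≤n

agreement : ∀ {m} → (Fin m → Bool) → (Fin m → Bool) → ℕ
agreement {m} y x = ∑[ i < m ] agree (y i) (x i)

agreement≤m : ∀ {m} y x → agreement {m} y x ≤ m
agreement≤m {m} y x = ≤-trans (∑-mono-≤ (λ i → agree≤1 (y i) (x i))) (≤-reflexive (trans (∑-const m 1) (*-identityʳ m)))

sumAll-2^agreement : ∀ m (y : Fin m → Bool) → sumAll m (λ x → 2 ^ agreement y x) ≡ 3 ^ m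
sumAll-2^agreement zero    y = refl
sumAll-2^agreement (suc m) y = begin
  sumAll m (λ x → 2 ^ (agree y₀ false + agreement (y ∘ Fin.suc) x)) + sumAll m (λ x → 2 ^ (agree y₀ true + agreement (y ∘ Fin.suc) x))
    ≡⟨ cong₂ _+_ (firstBit false) (firstBit true) ⟩
  2 ^ agree y₀ false * 3 ^ m + 2 ^ agree y₀ true * 3 ^ m
    ≡⟨ sym (*-distribʳ-+ (3 ^ m) (2 ^ agree y₀ false) _) ⟩
  (2 ^ agree y₀ false + 2 ^ agree y₀ true) * 3 ^ m
    ≡⟨ cong (_* 3 ^ m) (three y₀) ⟩
  3 * 3 ^ m ∎
  where
  open ≡-Reasoning
  y₀ = y Fin.zero
  three : ∀ b → 2 ^ agree b false + 2 ^ agree b true ≡ 3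
  three true  = refl
  three false = refl
  firstBit : ∀ b → sumAll m (λ x → 2 ^ (agree y₀ b + agreement (y ∘ Fin.suc) x)) ≡ 2 ^ agree y₀ b * 3 ^ m
  firstBit b = begin
    sumAll m (λ x → 2 ^ (agree y₀ b + agreement (y ∘ Fin.suc) x))
      ≡⟨ sumAll-cong m (λ x → ^-distribˡ-+-* 2 (agree y₀ b) (agreement (y ∘ Fin.suc) x)) ⟩
    sumAll m (λ x → 2 ^ agree y₀ b * 2 ^ agreement (y ∘ Fin.suc) x)
      ≡⟨ sumAll-*-distribˡ m (2 ^ agree y₀ b) _ ⟩
    2 ^ agree y₀ b * sumAll m (λ x → 2 ^ agreement (y ∘ Fin.suc) x)
      ≡⟨ cong (2 ^ agree y₀ b *_) (sumAll-2^agreement m (y ∘ Fin.suc)) ⟩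
    2 ^ agree y₀ b * 3 ^ m ∎

membership : ∀ {R} → Subset R → Fin R → ℕ
membership S r = indicator (lookup S r)

∑membership≡∣∣ : ∀ {R} (S : Subset R) → ∑[ r < R ] membership S r ≡ ∣ S ∣
∑membership≡∣∣ []          = refl
∑membership≡∣∣ (true ∷ S)  = cong suc (∑membership≡∣∣ S)
∑membership≡∣∣ (false ∷ S) = ∑membership≡∣∣ S

membership≤ : ∀ {R} (S : Subset R) r {k} → (r ∈ S → 1 ≤ k) → membership S r ≤ k
membership≤ S r r∈S⇒1≤k = indicator≤ (lookup S r) (r∈S⇒1≤k ∘ lookup⇒[]= r S)

atLeast : ℕ → ℕ → ℕ
atLeast zero    a       = 1
atLeast (suc h) zero    = 0
atLeast (suc h) (suc a) = atLeast h a

≤threshold+atLeast : ∀ m h a → a ≤ m → a ≤ h + m * atLeast h a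
≤threshold+atLeast m       zero    a       a≤m       = ≤-trans a≤m (≤-reflexive (sym (*-identityʳ m)))
≤threshold+atLeast m       (suc h) zero    _         = z≤n
≤threshold+atLeast (suc m) (suc h) (suc a) (s≤s a≤m) = s≤s (≤threshold+atLeast (suc m) h a (m≤n⇒m≤1+n a≤m))

2^*atLeast≤2^ : ∀ h a → 2 ^ h * atLeast h a ≤ 2 ^ a
2^*atLeast≤2^ zero    a       = subst (_≤ 2 ^ a) (sym (*-identityʳ 1)) (m^n>0 2 a)
2^*atLeast≤2^ (suc h) zero    = ≤-trans (≤-reflexive (*-zeroʳ (2 ^ suc h))) z≤n
2^*atLeast≤2^ (suc h) (suc a) = begin
  2 * 2 ^ h * atLeast h a   ≡⟨ *-assoc 2 (2 ^ h) (atLeast h a) ⟩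
  2 * (2 ^ h * atLeast h a) ≤⟨ *-monoʳ-≤ 2 (2^*atLeast≤2^ h a) ⟩
  2 * 2 ^ a                 ∎
  where open ≤-Reasoning

^-distribʳ-* : ∀ a c n → (a * c) ^ n ≡ a ^ n * c ^ n
^-distribʳ-* a c zero    = refl
^-distribʳ-* a c (suc n) = trans (cong (a * c *_) (^-distribʳ-* a c n)) (*-interchange a c (a ^ n) (c ^ n))

-- With threshold h = 42u = 3m/5, the bound ∑ₓ 2 ^ agreement ≤ 2 ^ b · 3 ^ m leaves at most 2 ^ m / 15 strings x
-- decoded correctly on h or more coordinates (as 2 · 3 ^ 70 ≤ 2 ^ 112), so the average agreement is at most
-- (3/5 + 1/15) m = 2m/3.
module Agreement (m u b : ℕ) (m≡70u : m ≡ 70 * u) (b+4≤u : b + 4 ≤ u) where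

  module _ (enc : (Fin m → Bool) → Fin (2 ^ b)) (dec : Fin (2 ^ b) → Fin m → Bool) where

    decodedCorrectly : (Fin m → Bool) → ℕ
    decodedCorrectly x = agreement (dec (enc x)) x

    heavy : ℕ
    heavy = sumAll m (λ x → atLeast (42 * u) (decodedCorrectly x))

    2^h*heavy≤ : 2 ^ (42 * u) * heavy ≤ 2 ^ b * 3 ^ m
    2^h*heavy≤ = begin
      2 ^ (42 * u) * heavy
        ≡⟨ sym (sumAll-*-distribˡ m (2 ^ (42 * u)) _) ⟩
      sumAll m (λ x → 2 ^ (42 * u) * atLeast (42 * u) (decodedCorrectly x))
        ≤⟨ sumAll-mono-≤ m (λ x → 2^*atLeast≤2^ (42 * u) (decodedCorrectly x)) ⟩
      sumAll m (λ x → 2 ^ decodedCorrectly x)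
        ≤⟨ sumAll-mono-≤ m (λ x → term≤∑ (λ s → 2 ^ agreement (dec s) x) (enc x)) ⟩
      sumAll m (λ x → ∑[ s < 2 ^ b ] (2 ^ agreement (dec s) x))
        ≡⟨ sumAll-∑-comm m (2 ^ b) _ ⟩
      ∑[ s < 2 ^ b ] sumAll m (λ x → 2 ^ agreement (dec s) x)
        ≡⟨ trans (sum-cong-≗ (λ s → sumAll-2^agreement m (dec s))) (∑-const (2 ^ b) (3 ^ m)) ⟩
      2 ^ b * 3 ^ m ∎
      where open ≤-Reasoning

    15*heavy≤2^m : 15 * heavy ≤ 2 ^ m
    15*heavy≤2^m = *-cancelˡ-≤ (2 ^ (42 * u)) {{m^n≢0 2 (42 * u)}} (begin
      2 ^ (42 * u) * (15 * heavy) ≡⟨ *-comm-middle 15 (2 ^ (42 * u)) heavy ⟩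
      15 * (2 ^ (42 * u) * heavy) ≤⟨ *-monoʳ-≤ 15 2^h*heavy≤ ⟩
      15 * (2 ^ b * 3 ^ m)        ≤⟨ *-monoˡ-≤ (2 ^ b * 3 ^ m) (n≤1+n 15) ⟩
      16 * (2 ^ b * 3 ^ m)        ≡⟨ sym (*-assoc 16 (2 ^ b) (3 ^ m)) ⟩
      16 * 2 ^ b * 3 ^ m          ≡⟨ cong (_* 3 ^ m) (trans (*-comm 16 (2 ^ b)) (sym (^-distribˡ-+-* 2 b 4))) ⟩
      2 ^ (b + 4) * 3 ^ m         ≤⟨ *-monoˡ-≤ (3 ^ m) (^-monoʳ-≤ 2 b+4≤u) ⟩
      2 ^ u * 3 ^ m               ≡⟨ cong (λ k → 2 ^ u * 3 ^ k) m≡70u ⟩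
      2 ^ u * 3 ^ (70 * u)        ≡⟨ cong (2 ^ u *_) (sym (^-*-assoc 3 70 u)) ⟩
      2 ^ u * (3 ^ 70) ^ u        ≡⟨ sym (^-distribʳ-* 2 (3 ^ 70) u) ⟩
      (2 * 3 ^ 70) ^ u            ≤⟨ ^-monoˡ-≤ u (≤ᵇ⇒≤ (2 * 3 ^ 70) (2 ^ 112) _) ⟩
      (2 ^ 112) ^ u               ≡⟨ ^-*-assoc 2 112 u ⟩
      2 ^ (112 * u)               ≡⟨ cong (2 ^_) (112u≡42u+70u u) ⟩
      2 ^ (42 * u + 70 * u)       ≡⟨ cong (λ k → 2 ^ (42 * u + k)) (sym m≡70u) ⟩
      2 ^ (42 * u + m)            ≡⟨ ^-distribˡ-+-* 2 (42 * u) m ⟩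
      2 ^ (42 * u) * 2 ^ m        ∎)
      where
      open ≤-Reasoning
      *-comm-middle : ∀ a p q → p * (a * q) ≡ a * (p * q)
      *-comm-middle = solve-∀
      112u≡42u+70u : ∀ u → 112 * u ≡ 42 * u + 70 * u
      112u≡42u+70u = solve-∀

    sumCorrect≤ : sumAll m decodedCorrectly ≤ 42 * u * 2 ^ m + m * heavy
    sumCorrect≤ = begin
      sumAll m decodedCorrectly
        ≤⟨ sumAll-mono-≤ m (λ x → ≤threshold+atLeast m (42 * u) (decodedCorrectly x) (agreement≤m _ x)) ⟩
      sumAll m (λ x → 42 * u + m * atLeast (42 * u) (decodedCorrectly x))
        ≡⟨ sumAll-distrib-+ m (λ _ → 42 * u) _ ⟩
      sumAll m (λ _ → 42 * u) + sumAll m (λ x → m * atLeast (42 * u) (decodedCorrectly x))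
        ≡⟨ cong₂ _+_ (trans (sumAll-const m (42 * u)) (*-comm (2 ^ m) (42 * u))) (sumAll-*-distribˡ m m _) ⟩
      42 * u * 2 ^ m + m * heavy ∎
      where open ≤-Reasoning

    3*sumCorrect≤ : 3 * sumAll m decodedCorrectly ≤ 2 * m * 2 ^ m
    3*sumCorrect≤ = begin
      3 * sumAll m decodedCorrectly             ≤⟨ *-monoʳ-≤ 3 sumCorrect≤ ⟩
      3 * (42 * u * 2 ^ m + m * heavy)          ≡⟨ cong (λ k → 3 * (42 * u * 2 ^ m + k * heavy)) m≡70u ⟩
      3 * (42 * u * 2 ^ m + 70 * u * heavy)     ≡⟨ expand u (2 ^ m) heavy ⟩
      126 * u * 2 ^ m + 14 * u * (15 * heavy)   ≤⟨ +-monoʳ-≤ (126 * u * 2 ^ m) (*-monoʳ-≤ (14 * u) 15*heavy≤2^m) ⟩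
      126 * u * 2 ^ m + 14 * u * 2 ^ m          ≡⟨ collect u (2 ^ m) ⟩
      2 * (70 * u) * 2 ^ m                      ≡⟨ cong (λ k → 2 * k * 2 ^ m) (sym m≡70u) ⟩
      2 * m * 2 ^ m                             ∎
      where
      open ≤-Reasoning
      expand : ∀ u M h → 3 * (42 * u * M + 70 * u * h) ≡ 126 * u * M + 14 * u * (15 * h)
      expand = solve-∀
      collect : ∀ u M → 126 * u * M + 14 * u * M ≡ 2 * (70 * u) * M
      collect = solve-∀

  module _ (R : ℕ) (enc : Fin R → (Fin m → Bool) → Fin (2 ^ b)) (dec : Fin R → Fin (2 ^ b) → Fin m → Bool)
           (S : (Fin m → Bool) → Fin m → Subset R) (good : ∀ x i r → r ∈ S x i → dec r (enc r x) i ≡ x i) where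

    successes≤ : sumAll m (λ x → ∑[ i < m ] ∣ S x i ∣) ≤ ∑[ r < R ] sumAll m (decodedCorrectly (enc r) (dec r))
    successes≤ = begin
      sumAll m (λ x → ∑[ i < m ] ∣ S x i ∣)
        ≡⟨ sumAll-cong m (λ x → sum-cong-≗ (λ i → sym (∑membership≡∣∣ (S x i)))) ⟩
      sumAll m (λ x → ∑[ i < m ] ∑[ r < R ] membership (S x i) r)
        ≤⟨ sumAll-mono-≤ m (λ x → ∑-mono-≤ (λ i → ∑-mono-≤ (λ r → membership≤agree x i r))) ⟩
      sumAll m (λ x → ∑[ i < m ] ∑[ r < R ] agree (dec r (enc r x) i) (x i))
        ≡⟨ sumAll-cong m (λ x → ∑-comm (λ i r → agree (dec r (enc r x) i) (x i))) ⟩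
      sumAll m (λ x → ∑[ r < R ] decodedCorrectly (enc r) (dec r) x)
        ≡⟨ sumAll-∑-comm m R (λ x r → decodedCorrectly (enc r) (dec r) x) ⟩
      ∑[ r < R ] sumAll m (decodedCorrectly (enc r) (dec r)) ∎
      where
      open ≤-Reasoning
      membership≤agree : ∀ x i r → membership (S x i) r ≤ agree (dec r (enc r x) i) (x i)
      membership≤agree x i r = membership≤ (S x i) r (λ r∈S →
        ≤-reflexive (sym (trans (cong (λ d → agree d (x i)) (good x i r r∈S)) (agree-refl (x i)))))

    noShortProtocol : (∀ x i → 2 * R < 3 * ∣ S x i ∣) → ⊥
    noShortProtocol likely = <⇒≱ 0<m*2^m (+-cancelˡ-≤ (R * (2 * m * 2 ^ m)) _ _ (begin
      R * (2 * m * 2 ^ m) + m * 2 ^ m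
        ≡⟨ regroup (2 ^ m) m R ⟩
      2 ^ m * (m * suc (2 * R))
        ≡⟨ sym (trans (sumAll-cong m (λ _ → ∑-const m _)) (sumAll-const m _)) ⟩
      sumAll m (λ x → ∑[ i < m ] suc (2 * R))
        ≤⟨ sumAll-mono-≤ m (λ x → ∑-mono-≤ (likely x)) ⟩
      sumAll m (λ x → ∑[ i < m ] (3 * ∣ S x i ∣))
        ≡⟨ trans (sumAll-cong m (λ x → sym (*-distribˡ-sum 3 (λ i → ∣ S x i ∣)))) (sumAll-*-distribˡ m 3 _) ⟩
      3 * sumAll m (λ x → ∑[ i < m ] ∣ S x i ∣)
        ≤⟨ *-monoʳ-≤ 3 successes≤ ⟩
      3 * ∑[ r < R ] sumAll m (decodedCorrectly (enc r) (dec r))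
        ≡⟨ *-distribˡ-sum 3 (λ r → sumAll m (decodedCorrectly (enc r) (dec r))) ⟩
      ∑[ r < R ] (3 * sumAll m (decodedCorrectly (enc r) (dec r)))
        ≤⟨ ∑-mono-≤ (λ r → 3*sumCorrect≤ (enc r) (dec r)) ⟩
      ∑[ r < R ] (2 * m * 2 ^ m)
        ≡⟨ trans (∑-const R _) (sym (+-identityʳ _)) ⟩
      R * (2 * m * 2 ^ m) + 0 ∎))
      where
      open ≤-Reasoning
      regroup : ∀ M m R → R * (2 * m * M) + m * M ≡ M * (m * suc (2 * R))
      regroup = solve-∀
      0<m*2^m : 0 < m * 2 ^ m
      0<m*2^m = *-mono-≤ (subst (1 ≤_) (sym m≡70u) (≤-trans (s≤s z≤n) (*-monoʳ-≤ 70 (≤-trans (s≤s z≤n) (≤-trans (m≤n+m 4 b) b+4≤u))))) (m^n>0 2 m)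

filterᵇ-++-∁ : ∀ {A : Set} (p : A → Bool) xs → filterᵇ p xs ++ filterᵇ (not ∘ p) xs ↭ xs
filterᵇ-++-∁ p []       = ↭.refl
filterᵇ-++-∁ p (x ∷ xs) with p x
... | true  = prep x (filterᵇ-++-∁ p xs)
... | false = ↭.trans (shift x (filterᵇ p xs) (filterᵇ (not ∘ p) xs)) (prep x (filterᵇ-++-∁ p xs))

map-filterᵇ : ∀ {A B : Set} (p : A → Bool) (f g : A → B) xs → (∀ x → p x ≡ true → f x ≡ g x) →
              map f (filterᵇ p xs) ≡ map g (filterᵇ p xs)
map-filterᵇ p f g []       f≡g = refl
map-filterᵇ p f g (x ∷ xs) f≡g with p x in px
... | true  = cong₂ _∷_ (f≡g x px) (map-filterᵇ p f g xs f≡g)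
... | false = map-filterᵇ p f g xs f≡g

module Reduction (n v : ℕ) where

  LA : ℕ
  LA = 70 * v

  open Gadget v LA

  bits : (Fin (LA * v) → Bool) → ℕ → ℕ → Bool
  bits x a p with a <? LA | p <? v
  ... | yes a<LA | yes p<v = x (combine (fromℕ< a<LA) (fromℕ< p<v))
  ... | _        | _       = false

  bits-combine : ∀ x (a : Fin LA) (p : Fin v) → bits x (toℕ a) (toℕ p) ≡ x (combine a p)
  bits-combine x a p with toℕ a <? LA | toℕ p <? v
  ... | yes a<LA | yes p<v = cong₂ (λ a′ p′ → x (combine a′ p′)) (fromℕ<-toℕ a a<LA) (fromℕ<-toℕ p p<v)
  ... | no  a≮LA | _       = ⊥-elim (a≮LA (toℕ<n a))
  ... | yes _    | no p≮v  = ⊥-elim (p≮v (toℕ<n p))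

  row column : Fin (LA * v) → ℕ
  row    i = toℕ (proj₁ (remQuot {LA} v i))
  column i = toℕ (proj₂ (remQuot {LA} v i))

  bits-index : ∀ x i → bits x (row i) (column i) ≡ x i
  bits-index x i = trans (bits-combine x (proj₁ (remQuot {LA} v i)) (proj₂ (remQuot {LA} v i)))
                         (cong x (combine-remQuot {LA} v i))

  instanceOf : (Fin (LA * v) → Bool) → Fin (LA * v) → Labeling n
  instanceOf x i = labeling (bits x) (row i) (column i)

  isAliceEdge : Edge n → Bool
  isAliceEdge (i , j) = aliceEdge (toℕ i) (toℕ j)

  aliceEdges otherEdges : List (Edge n)
  aliceEdges = filterᵇ isAliceEdge (allEdges n)
  otherEdges = filterᵇ (not ∘ isAliceEdge) (allEdges n)

  aliceFirst-valid : ValidOrder n (aliceEdges ++ otherEdges)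
  aliceFirst-valid = filterᵇ-++-∁ isAliceEdge (allEdges n)

  aliceStream : (Fin (LA * v) → Bool) → List (StreamItem n)
  aliceStream x = streamOf (λ i j → aliceLabel (bits x) (toℕ i) (toℕ j)) aliceEdges

  bobStream : Fin (LA * v) → List (StreamItem n)
  bobStream k = streamOf (λ i j → canonical (row k) (column k) (toℕ i) ≡ᵇ canonical (row k) (column k) (toℕ j)) otherEdges

  stream-split : ∀ x k → streamOf (instanceOf x k) (aliceEdges ++ otherEdges) ≡ aliceStream x ++ bobStream k
  stream-split x k = trans (map-++ _ aliceEdges otherEdges) (cong₂ _++_
    (map-filterᵇ isAliceEdge _ _ (allEdges n) (λ { (i , j) on → cong (λ b → (i , j , b)) (chooseLabel on) }))
    (map-filterᵇ (not ∘ isAliceEdge) _ _ (allEdges n) (λ { (i , j) off → cong (λ b → (i , j , b)) (chooseLabel (not-true off)) })))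
    where
    chooseLabel : ∀ {i j} {e : Bool} → aliceEdge i j ≡ e →
                  label (bits x) (row k) (column k) i j
                  ≡ (if e then aliceLabel (bits x) i j else (canonical (row k) (column k) i ≡ᵇ canonical (row k) (column k) j))
    chooseLabel refl = refl
    not-true : ∀ {b} → not b ≡ true → b ≡ false
    not-true {false} _ = refl

  module _ {b R : ℕ} (A : StreamAlg n b R) (correct : Correct A) (TOT≤n : TOT ≤ n) (3≤n : 3 ≤ n) where

    enc : Fin R → (Fin (LA * v) → Bool) → Fin (2 ^ b)
    enc r x = foldl (step A r) (init A r) (aliceStream x)

    dec : Fin R → Fin (2 ^ b) → Fin (LA * v) → Bool
    dec r s k = output A r (foldl (step A r) s (bobStream k)) <ᵇ LA * v

    goodSeeds : (Fin (LA * v) → Bool) → Fin (LA * v) → Subset R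
    goodSeeds x k = proj₁ (correct (instanceOf x k) (aliceEdges ++ otherEdges) aliceFirst-valid)

    run-split : ∀ x k r → run A r (streamOf (instanceOf x k) (aliceEdges ++ otherEdges))
                          ≡ output A r (foldl (step A r) (enc r x) (bobStream k))
    run-split x k r = cong (output A r) (trans (cong (foldl (step A r) (init A r)) (stream-split x k))
                                               (foldl-++ (step A r) (init A r) (aliceStream x) (bobStream k)))

    goodSeed-decodes : ∀ x k r → r ∈ goodSeeds x k → dec r (enc r x) k ≡ x k
    goodSeed-decodes x k r r∈S = begin
      dec r (enc r x) k
        ≡⟨ cong (_<ᵇ LA * v) (sym (run-split x k r)) ⟩
      (run A r (streamOf (instanceOf x k) (aliceEdges ++ otherEdges)) <ᵇ LA * v)
        ≡⟨ optimalCost-decodes (row k) (column k) n 3≤n (bits x) TOT≤n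
             (toℕ<n (proj₁ (remQuot {LA} v k))) (toℕ<n (proj₂ (remQuot {LA} v k))) _
             (proj₂ (proj₂ (correct (instanceOf x k) (aliceEdges ++ otherEdges) aliceFirst-valid)) r r∈S) ⟩
      bits x (row k) (column k)
        ≡⟨ bits-index x k ⟩
      x k ∎
      where open ≡-Reasoning

    v*v≤b+3 : v * v ≤ b + 3
    v*v≤b+3 = ≮⇒≥ λ b+3<v*v →
      Agreement.noShortProtocol (LA * v) (v * v) b (*-assoc 70 v v) (subst (_≤ v * v) (sym (+-suc b 3)) b+3<v*v)
        R enc dec goodSeeds goodSeed-decodes
        (λ x k → proj₁ (proj₂ (correct (instanceOf x k) (aliceEdges ++ otherEdges) aliceFirst-valid)))

TOT≡146v : ∀ v → Gadget.TOT v (70 * v) ≡ 146 * v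
TOT≡146v = blocks
  where
  blocks : ∀ v → 70 * v + (v + v) + (70 * v + (v + v)) + (v + v) ≡ 146 * v
  blocks = solve-∀

146*[n/146]≤n : ∀ n → 146 * (n / 146) ≤ n
146*[n/146]≤n n = subst (_≤ n) (*-comm (n / 146) 146) (m/n*n≤m n 146)

n≤219*[n/146] : ∀ n → 292 ≤ n → n ≤ 219 * (n / 146)
n≤219*[n/146] n 292≤n = begin
  n                            ≡⟨ m≡m%n+[m/n]*n n 146 ⟩
  n % 146 + n / 146 * 146      ≤⟨ +-monoˡ-≤ (n / 146 * 146) (≤-pred (m%n<n n 146)) ⟩
  145 + n / 146 * 146          ≤⟨ +-monoˡ-≤ (n / 146 * 146) (≤-trans (n≤1+n 145) (*-monoʳ-≤ 73 2≤n/146)) ⟩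
  73 * (n / 146) + n / 146 * 146 ≡⟨ collect (n / 146) ⟩
  219 * (n / 146)              ∎
  where
  open ≤-Reasoning
  2≤n/146 : 2 ≤ n / 146
  2≤n/146 = /-monoˡ-≤ 146 292≤n
  collect : ∀ v → 73 * v + v * 146 ≡ 219 * v
  collect = solve-∀

n*n≤191844*b : ∀ n v b → n ≤ 219 * v → 2 ≤ v → v * v ≤ b + 3 → n * n ≤ 191844 * b
n*n≤191844*b n v b n≤219v 2≤v v*v≤b+3 = begin
  n * n                 ≤⟨ *-mono-≤ n≤219v n≤219v ⟩
  219 * v * (219 * v)   ≡⟨ square v ⟩
  47961 * (v * v)       ≤⟨ *-monoʳ-≤ 47961 (≤-trans v*v≤b+3 b+3≤4b) ⟩
  47961 * (4 * b)       ≡⟨ *-assoc 47961 4 b ⟨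
  191844 * b            ∎
  where
  open ≤-Reasoning
  square : ∀ v → 219 * v * (219 * v) ≡ 47961 * (v * v)
  square = solve-∀
  1≤b : 1 ≤ b
  1≤b = +-cancelʳ-≤ 3 1 b (≤-trans (*-mono-≤ 2≤v 2≤v) v*v≤b+3)
  b+3b≡4b : ∀ b → b + 3 * b ≡ 4 * b
  b+3b≡4b = solve-∀
  b+3≤4b : b + 3 ≤ 4 * b
  b+3≤4b = ≤-trans (+-monoʳ-≤ b (*-monoʳ-≤ 3 1≤b)) (≤-reflexive (b+3b≡4b b))

proposition2 : ∃[ C ] ∃[ N ] (∀ (n b R : ℕ) → N ≤ n → (A : StreamAlg n b R) → Correct A → n * n ≤ C * b)
proposition2 = 191844 , 292 , λ n b R 292≤n A correct →
  n*n≤191844*b n (n / 146) b (n≤219*[n/146] n 292≤n) (/-monoˡ-≤ 146 292≤n)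
    (Reduction.v*v≤b+3 n (n / 146) A correct
      (subst (_≤ n) (sym (TOT≡146v (n / 146))) (146*[n/146]≤n n))
      (≤-trans (s≤s (s≤s (s≤s z≤n))) 292≤n))
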